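{- Let $R$ be a finite ring with unity and $x\in R$. Then $$|[x]_{\ell}|=\sum_{\substack{I \text{ left ideal of } R\\ I\subseteq (x)_{\ell}}}|I|\,\mu_R(I,(x)_{\ell}).$$
   Context: Rings are associative with unity, not necessarily commutative. $(x)_\ell$ denotes the left ideal of $R$ generated by $x$, and $[x]_\ell=\{y\in R:(y)_\ell=(x)_\ell\}$. For a left ideal $J$ of $R$, a maximal $R$-left ideal of $J$ is a left ideal $M$ of $R$ with $M\subsetneq J$ such that there is no left ideal $L$ of $R$ with $M\subsetneq L\subsetneq J$; $\mathcal{M}_R(J)$ is the set of these. For left ideals $I\subseteq J$ of $R$, define $\mu_R(I,J)=1$ if $I=J$; if $I\neq J$ and $I=\bigcap_{M\in E}M$ for some nonempty $E\subseteq\mathcal{M}_R(J)$, define $\mu_R(I,J)=e-o$, where $e$ (resp. $o$) is the number of subsets $E\subseteq\mathcal{M}_R(J)$ of even (resp. odd) cardinality with $\bigcap_{M\in E}M=I$; otherwise $\mu_R(I,J)=0$. -}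

module Defs where

open import Level using (Level)
open import Algebra.Bundles using (Ring)
open import Function.Bundles using (Inverse)
open import Data.Nat using (ℕ; zero; suc)
open import Data.Integer as ℤ using (ℤ; +_)
open import Data.Bool using (Bool; true; false)
import Data.Bool as Bool
open import Data.Fin using (Fin)
open import Data.Fin.Properties using (any?; all?)
import Data.Fin.Properties as FinP
open import Data.Fin.Subset using (Subset; _∈_; _⊆_; _⊂_; ⋂; ∣_∣)
open import Data.Fin.Subset.Properties using (_∈?_; _⊆?_; _⊂?_; anySubset?)
open import Data.Vec using (Vec; []; _∷_; tabulate)
open import Data.Vec.Properties using (≡-dec)
open import Data.List using (List; []; _∷_; [_]; _++_; map; filter; foldr; length)
open import Data.Product using (_×_; _,_; ∃; ∃-syntax)
open import Relation.Nullary using (Dec; yes; no; ¬_; does)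
open import Relation.Nullary.Decidable using (_×-dec_; _→-dec_; ¬?)
open import Relation.Binary.PropositionalEquality using (_≡_; _≢_; setoid)
open import Relation.Unary using (Pred; Decidable)

allSubsets : ∀ n → List (Subset n)
allSubsets zero    = [ [] ]
allSubsets (suc n) = map (true ∷_) (allSubsets n) ++ map (false ∷_) (allSubsets n)

-- all sublists of a list (= all subsets of its set of positions)
sublists : ∀ {a} {A : Set a} → List A → List (List A)
sublists []       = [ [] ]
sublists (x ∷ xs) = map (x ∷_) (sublists xs) ++ sublists xs

sumℤ : List ℤ → ℤ
sumℤ = foldr ℤ._+_ (+ 0)

sign : ℕ → ℤ
sign zero    = + 1
sign (suc k) = ℤ.- sign k

_≟ₛ_ : ∀ {n} (p q : Subset n) → Dec (p ≡ q)
_≟ₛ_ = ≡-dec Bool._≟_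

-- Subsets of R are
-- represented as subsets of Fin n via this enumeration; the ring
-- operations are transported along it.

module FiniteRing {c ℓ} (R : Ring c ℓ) {n : ℕ}
                  (enum : Inverse (setoid (Fin n)) (Ring.setoid R)) where

  open Ring R
  open Inverse enum renaming (to to elt; from to idx)

  0ᵢ : Fin n
  0ᵢ = idx 0#

  _+ᵢ_ : Fin n → Fin n → Fin n
  i +ᵢ j = idx (elt i + elt j)

  -ᵢ_ : Fin n → Fin n
  -ᵢ i = idx (- elt i)

  _*ᵢ_ : Fin n → Fin n → Fin n
  i *ᵢ j = idx (elt i * elt j)

  IsLeftIdeal : Subset n → Set
  IsLeftIdeal S =
      (0ᵢ ∈ S)
    × (∀ i j → i ∈ S → j ∈ S → (i +ᵢ j) ∈ S)
    × (∀ i → i ∈ S → (-ᵢ i) ∈ S)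
    × (∀ r i → i ∈ S → (r *ᵢ i) ∈ S)

  isLeftIdeal? : Decidable IsLeftIdeal
  isLeftIdeal? S =
        (0ᵢ ∈? S)
    ×-dec all? (λ i → all? (λ j → (i ∈? S) →-dec ((j ∈? S) →-dec ((i +ᵢ j) ∈? S))))
    ×-dec all? (λ i → (i ∈? S) →-dec ((-ᵢ i) ∈? S))
    ×-dec all? (λ r → all? (λ i → (i ∈? S) →-dec ((r *ᵢ i) ∈? S)))

  -- (x)_ℓ = R x, the left ideal generated by x (R has unity)
  ⟨_⟩ℓ : Carrier → Subset n
  ⟨ x ⟩ℓ = tabulate (λ i → does (any? (λ r → FinP._≟_ i (r *ᵢ idx x))))

  [_]ℓ : Carrier → Subset n
  [ x ]ℓ = tabulate (λ i → does (⟨ elt i ⟩ℓ ≟ₛ ⟨ x ⟩ℓ))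

  leftIdeals : List (Subset n)
  leftIdeals = filter isLeftIdeal? (allSubsets n)

  IsMaximalIn : Subset n → Subset n → Set
  IsMaximalIn J M =
      IsLeftIdeal M
    × M ⊂ J
    × ¬ (∃[ L ] (IsLeftIdeal L × M ⊂ L × L ⊂ J))

  isMaximalIn? : ∀ J → Decidable (IsMaximalIn J)
  isMaximalIn? J M =
        isLeftIdeal? M
    ×-dec (M ⊂? J)
    ×-dec ¬? (anySubset? (λ L → isLeftIdeal? L ×-dec (M ⊂? L) ×-dec (L ⊂? J)))

  𝓜 : Subset n → List (Subset n)
  𝓜 J = filter (isMaximalIn? J) (allSubsets n)

  NonEmpty : ∀ {a} {A : Set a} → List A → Set a
  NonEmpty xs = xs ≢ []

  nonEmpty? : ∀ {a} {A : Set a} → (xs : List A) → Dec (NonEmpty xs)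
  nonEmpty? []      = no (λ ne → ne _≡_.refl)
  nonEmpty? (_ ∷ _) = yes (λ ())

  -- μ_R(I,J).  For I ≠ J this is e - o = Σ_{E} (-1)^|E| over the
  -- nonempty E ⊆ 𝓜_R(J) with ⋂E = I; this sum is 0 when no such E exists.
  μ : Subset n → Subset n → ℤ
  μ I J with I ≟ₛ J
  ... | yes _ = + 1
  ... | no  _ = sumℤ (map (λ E → sign (length E))
                        (filter (λ E → nonEmpty? E ×-dec (⋂ E ≟ₛ I)) (sublists (𝓜 J))))

  rhs : Carrier → ℤ
  rhs x = sumℤ (map (λ I → (+ ∣ I ∣) ℤ.* μ I ⟨ x ⟩ℓ)
                    (filter (λ I → I ⊆? ⟨ x ⟩ℓ) leftIdeals))

{-# OPTIONS --safe #-}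
module Submission where

-- For y ∈ J = (x)_ℓ, the left ideal (y)_ℓ is a proper left subideal of J iff it lies in a
-- maximal R-left ideal of J (R is finite), iff y does; so [x]_ℓ = J ∖ ⋃ 𝓜(J).
-- Inclusion–exclusion over the subfamilies E ⊆ 𝓜(J) gives |[x]_ℓ| = Σ_E (-1)^|E| |J ∩ ⋂E|,
-- and each J ∩ ⋂E is a left ideal inside J. Grouping the terms by I = J ∩ ⋂E turns the
-- coefficient of |I| into μ_R(I, J): only E = ∅ yields I = J, and for I ≠ J the E involved
-- are exactly the nonempty ones with ⋂E = I.

open import Defs
open import Algebra.Bundles using (Ring; AbelianGroup)
open import Function.Bundles using (Inverse; Injection)
open import Function.Properties.Inverse using (Inverse⇒Injection)
open import Function using (_∘_)
open import Data.Nat as ℕ using (ℕ; suc)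
import Data.Nat.Properties as ℕ
open import Data.Bool using (true; false; if_then_else_)
open import Data.Fin using (Fin)
open import Data.Fin.Properties using (any?)
import Data.Fin.Properties as FinP
open import Data.Fin.Subset
  using (Subset; _∈_; _∉_; _⊆_; _⊂_; _⊃_; _∩_; _∪_; _─_; ⋂; ⋃; ⊤; ⊥; ∣_∣; inside; outside)
open import Data.Fin.Subset.Properties
  using ( _∈?_; _⊆?_; _⊂?_; anySubset?; ∈⊤; ∉⊥; x∈p∩q⁺; x∈p∩q⁻; x∈p∪q⁺; x∈p∪q⁻; x∈p∧x∉q⇒x∈p─q
        ; p─q⊆p; p─⊥≡p; p─q─r≡p─q∪r; p∩q⊆p; p∩q⊆q; ∩-assoc; ∩-identityʳ; ∪-comm
        ; ⊆-refl; ⊆-trans; ⊆-antisym; ⊆-⊂-trans; ⊂-irref )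
open import Data.Fin.Subset.Induction using (⊃-wellFounded)
open import Induction.WellFounded using (Acc; acc)
open import Data.Vec using ([]; _∷_; here; there; tabulate)
open import Data.Vec.Properties using (lookup∘tabulate; []=⇒lookup; lookup⇒[]=)
open import Data.List using (List; []; _∷_; _++_; map; filter; length)
import Data.List.Membership.Propositional as List
open import Data.List.Membership.Propositional using (lose)
open import Data.List.Membership.Propositional.Properties using (∈-map⁺; ∈-++⁺ˡ; ∈-++⁺ʳ; ∈-filter⁺)
open import Data.List.Relation.Unary.All using (All; []; _∷_; lookupWith)
import Data.List.Relation.Unary.All as All
import Data.List.Relation.Unary.All.Properties as All
open import Data.List.Relation.Unary.Any using (Any; here; there)
open import Data.Product using (_×_; _,_; proj₁; proj₂; ∃-syntax)
open import Data.Sum using (inj₁; inj₂)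
open import Data.Empty using (⊥-elim)
open import Relation.Nullary using (Dec; yes; no; does; ¬_)
open import Relation.Nullary.Decidable using (dec-true; dec-false; _×-dec_; ¬?)
open import Relation.Unary using (Pred; Decidable)
open import Relation.Binary.PropositionalEquality as ≡ using (_≡_; _≢_; refl; cong; cong₂; subst; setoid)

private variable n : ℕ

∈-allSubsets : ∀ (p : Subset n) → p List.∈ allSubsets n
∈-allSubsets []            = here refl
∈-allSubsets (inside  ∷ p) = ∈-++⁺ˡ (∈-map⁺ (inside ∷_) (∈-allSubsets p))
∈-allSubsets (outside ∷ p) = ∈-++⁺ʳ _ (∈-map⁺ (outside ∷_) (∈-allSubsets p))

module _ {p} {P : Pred (Fin n) p} (P? : Decidable P) where

  ∈-tabulate⁺ : ∀ {i} → P i → i ∈ tabulate (λ j → does (P? j))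
  ∈-tabulate⁺ {i} Pi = lookup⇒[]= i _ (≡.trans (lookup∘tabulate _ i) (dec-true (P? i) Pi))

  ∈-tabulate⁻ : ∀ {i} → i ∈ tabulate (λ j → does (P? j)) → P i
  ∈-tabulate⁻ {i} i∈ with P? i | ≡.trans (≡.sym (lookup∘tabulate _ i)) ([]=⇒lookup i∈)
  ... | yes Pi | _  = Pi
  ... | no  _  | ()

⊆∧≢⇒⊂ : ∀ {p q : Subset n} → p ⊆ q → p ≢ q → p ⊂ q
⊆∧≢⇒⊂ {p = p} {q} p⊆q p≢q with any? (λ i → i ∈? q ×-dec ¬? (i ∈? p))
... | yes (i , i∈q , i∉p) = p⊆q , i , i∈q , i∉p
... | no  ∄i = ⊥-elim (p≢q (⊆-antisym p⊆q q⊆p))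
  where
  q⊆p : q ⊆ p
  q⊆p {i} i∈q with i ∈? p
  ... | yes i∈p = i∈p
  ... | no  i∉p = ⊥-elim (∄i (i , i∈q , i∉p))

p⊆q⇒q∩p≡p : ∀ {p q : Subset n} → p ⊆ q → q ∩ p ≡ p
p⊆q⇒q∩p≡p {p = p} {q} p⊆q = ⊆-antisym (p∩q⊆q q p) (λ i∈p → x∈p∩q⁺ (p⊆q i∈p , i∈p))

p⊂q⇒q∩p≢q : ∀ {p q : Subset n} → p ⊂ q → q ∩ p ≢ q
p⊂q⇒q∩p≢q p⊂q q∩p≡q = ⊂-irref (≡.trans (≡.sym (p⊆q⇒q∩p≡p (proj₁ p⊂q))) q∩p≡q) p⊂q

p⊂r⇒p∩q⊂r : ∀ {p q r : Subset n} → p ⊂ r → p ∩ q ⊂ r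
p⊂r⇒p∩q⊂r {p = p} {q} = ⊆-⊂-trans (p∩q⊆p p q)

x∈p─q⇒x∉q : ∀ {p q : Subset n} {i} → i ∈ p ─ q → i ∉ q
x∈p─q⇒x∉q {p = inside ∷ p} {outside ∷ q} here      ()
x∈p─q⇒x∉q {p = _      ∷ p} {_       ∷ q} (there m) (there i∈q) = x∈p─q⇒x∉q m i∈q

x∈⋃⁺ : ∀ {i} {Ms : List (Subset n)} → Any (i ∈_) Ms → i ∈ ⋃ Ms
x∈⋃⁺ (here  i∈M)  = x∈p∪q⁺ (inj₁ i∈M)
x∈⋃⁺ (there i∈Ms) = x∈p∪q⁺ (inj₂ (x∈⋃⁺ i∈Ms))

x∈⋃⁻ : ∀ {i} (Ms : List (Subset n)) → i ∈ ⋃ Ms → Any (i ∈_) Ms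
x∈⋃⁻ []       i∈⊥ = ⊥-elim (∉⊥ i∈⊥)
x∈⋃⁻ (M ∷ Ms) i∈M∪Ms with x∈p∪q⁻ M (⋃ Ms) i∈M∪Ms
... | inj₁ i∈M  = here i∈M
... | inj₂ i∈Ms = there (x∈⋃⁻ Ms i∈Ms)

∣p∣≡∣p∩q∣+∣p─q∣ : ∀ (p q : Subset n) → ∣ p ∣ ≡ ∣ p ∩ q ∣ ℕ.+ ∣ p ─ q ∣
∣p∣≡∣p∩q∣+∣p─q∣ []            []            = refl
∣p∣≡∣p∩q∣+∣p─q∣ (inside  ∷ p) (inside  ∷ q) = cong suc (∣p∣≡∣p∩q∣+∣p─q∣ p q)
∣p∣≡∣p∩q∣+∣p─q∣ (inside  ∷ p) (outside ∷ q) =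
  ≡.trans (cong suc (∣p∣≡∣p∩q∣+∣p─q∣ p q)) (≡.sym (ℕ.+-suc _ _))
∣p∣≡∣p∩q∣+∣p─q∣ (outside ∷ p) (inside  ∷ q) = ∣p∣≡∣p∩q∣+∣p─q∣ p q
∣p∣≡∣p∩q∣+∣p─q∣ (outside ∷ p) (outside ∷ q) = ∣p∣≡∣p∩q∣+∣p─q∣ p q

p─q∩r≡p∩r─q : ∀ (p q r : Subset n) → (p ─ q) ∩ r ≡ p ∩ r ─ q
p─q∩r≡p∩r─q []      []            []      = refl
p─q∩r≡p∩r─q (x ∷ p) (inside  ∷ q) (z ∷ r) = cong (outside ∷_) (p─q∩r≡p∩r─q p q r)
p─q∩r≡p∩r─q (x ∷ p) (outside ∷ q) (z ∷ r) = cong (_ ∷_) (p─q∩r≡p∩r─q p q r)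

module LeftIdeals {c ℓ} (R : Ring c ℓ) (enum : Inverse (setoid (Fin n)) (Ring.setoid R)) where

  open Ring R hiding (refl; sym; trans; setoid)
  open FiniteRing R enum
  open Inverse enum renaming (to to elt; from to idx)
  open import Algebra.Properties.Ring R using (-‿distribˡ-*)
  open import Relation.Binary.Reasoning.Setoid (Ring.setoid R)

  elt-idx : ∀ a → elt (idx a) ≈ a
  elt-idx = strictlyInverseˡ

  elt-injective : ∀ {i j} → elt i ≈ elt j → i ≡ j
  elt-injective = Injection.injective (Inverse⇒Injection enum)

  multiple? : ∀ y i → Dec (∃[ s ] i ≡ s *ᵢ idx y)
  multiple? y i = any? (λ s → FinP._≟_ i (s *ᵢ idx y))

  ∈⟨⟩ℓ⁺ : ∀ {y i} r → elt i ≈ r * y → i ∈ ⟨ y ⟩ℓ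
  ∈⟨⟩ℓ⁺ {y} {i} r i≈ry = ∈-tabulate⁺ (multiple? y) (idx r , elt-injective (begin
    elt i                      ≈⟨ i≈ry ⟩
    r * y                      ≈⟨ *-cong (elt-idx r) (elt-idx y) ⟨
    elt (idx r) * elt (idx y)  ≈⟨ elt-idx _ ⟨
    elt (idx r *ᵢ idx y)       ∎))

  ∈⟨⟩ℓ⁻ : ∀ {y i} → i ∈ ⟨ y ⟩ℓ → ∃[ r ] elt i ≈ r * y
  ∈⟨⟩ℓ⁻ {y} {i} i∈ with ∈-tabulate⁻ (multiple? y) i∈
  ... | s , i≡sy = elt s , (begin
    elt i                  ≡⟨ cong elt i≡sy ⟩
    elt (s *ᵢ idx y)       ≈⟨ elt-idx _ ⟩
    elt s * elt (idx y)    ≈⟨ *-congˡ (elt-idx y) ⟩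
    elt s * y              ∎)

  ⟨⟩ℓ-isLeftIdeal : ∀ y → IsLeftIdeal ⟨ y ⟩ℓ
  ⟨⟩ℓ-isLeftIdeal y = 0∈ , +-closed , neg-closed , *-closed
    where
    0∈ : 0ᵢ ∈ ⟨ y ⟩ℓ
    0∈ = ∈⟨⟩ℓ⁺ 0# (begin elt (idx 0#) ≈⟨ elt-idx 0# ⟩ 0# ≈⟨ zeroˡ y ⟨ 0# * y ∎)

    +-closed : ∀ i j → i ∈ ⟨ y ⟩ℓ → j ∈ ⟨ y ⟩ℓ → (i +ᵢ j) ∈ ⟨ y ⟩ℓ
    +-closed i j i∈ j∈ with ∈⟨⟩ℓ⁻ i∈ | ∈⟨⟩ℓ⁻ j∈
    ... | a , i≈ay | b , j≈by = ∈⟨⟩ℓ⁺ (a + b) (begin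
      elt (i +ᵢ j)   ≈⟨ elt-idx _ ⟩
      elt i + elt j  ≈⟨ +-cong i≈ay j≈by ⟩
      a * y + b * y  ≈⟨ distribʳ y a b ⟨
      (a + b) * y    ∎)

    neg-closed : ∀ i → i ∈ ⟨ y ⟩ℓ → (-ᵢ i) ∈ ⟨ y ⟩ℓ
    neg-closed i i∈ with ∈⟨⟩ℓ⁻ i∈
    ... | a , i≈ay = ∈⟨⟩ℓ⁺ (- a) (begin
      elt (-ᵢ i)   ≈⟨ elt-idx _ ⟩
      - elt i      ≈⟨ -‿cong i≈ay ⟩
      - (a * y)    ≈⟨ -‿distribˡ-* a y ⟩
      - a * y      ∎)

    *-closed : ∀ r i → i ∈ ⟨ y ⟩ℓ → (r *ᵢ i) ∈ ⟨ y ⟩ℓ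
    *-closed r i i∈ with ∈⟨⟩ℓ⁻ i∈
    ... | a , i≈ay = ∈⟨⟩ℓ⁺ (elt r * a) (begin
      elt (r *ᵢ i)     ≈⟨ elt-idx _ ⟩
      elt r * elt i    ≈⟨ *-congˡ i≈ay ⟩
      elt r * (a * y)  ≈⟨ *-assoc _ _ _ ⟨
      elt r * a * y    ∎)

  x∈⟨x⟩ℓ : ∀ i → i ∈ ⟨ elt i ⟩ℓ
  x∈⟨x⟩ℓ i = ∈⟨⟩ℓ⁺ 1# (Ring.sym R (*-identityˡ (elt i)))

  ⟨⟩ℓ-least : ∀ {S i} → IsLeftIdeal S → i ∈ S → ⟨ elt i ⟩ℓ ⊆ S
  ⟨⟩ℓ-least {S} {i} (_ , _ , _ , *-closed) i∈S {j} j∈ with ∈⟨⟩ℓ⁻ j∈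
  ... | r , j≈ri = subst (_∈ S) (≡.sym j≡ri) (*-closed (idx r) i i∈S)
    where
    j≡ri : j ≡ idx r *ᵢ i
    j≡ri = elt-injective (begin
      elt j                ≈⟨ j≈ri ⟩
      r * elt i            ≈⟨ *-congʳ (elt-idx r) ⟨
      elt (idx r) * elt i  ≈⟨ elt-idx _ ⟨
      elt (idx r *ᵢ i)     ∎)

  ⊤-isLeftIdeal : IsLeftIdeal ⊤
  ⊤-isLeftIdeal = ∈⊤ , (λ _ _ _ _ → ∈⊤) , (λ _ _ → ∈⊤) , (λ _ _ _ → ∈⊤)

  ∩-isLeftIdeal : ∀ {S T} → IsLeftIdeal S → IsLeftIdeal T → IsLeftIdeal (S ∩ T)
  ∩-isLeftIdeal {S} {T} (0∈S , +S , -S , *S) (0∈T , +T , -T , *T) =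
      x∈p∩q⁺ (0∈S , 0∈T)
    , (λ i j i∈ j∈ → both (+S i j (inS i∈) (inS j∈)) (+T i j (inT i∈) (inT j∈)))
    , (λ i i∈ → both (-S i (inS i∈)) (-T i (inT i∈)))
    , (λ r i i∈ → both (*S r i (inS i∈)) (*T r i (inT i∈)))
    where
    inS : ∀ {i} → i ∈ S ∩ T → i ∈ S
    inS = proj₁ ∘ x∈p∩q⁻ S T
    inT : ∀ {i} → i ∈ S ∩ T → i ∈ T
    inT = proj₂ ∘ x∈p∩q⁻ S T
    both : ∀ {i} → i ∈ S → i ∈ T → i ∈ S ∩ T
    both i∈S i∈T = x∈p∩q⁺ (i∈S , i∈T)

  ⋂-isLeftIdeal : ∀ {Ms} → All IsLeftIdeal Ms → IsLeftIdeal (⋂ Ms)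
  ⋂-isLeftIdeal []       = ⊤-isLeftIdeal
  ⋂-isLeftIdeal (M ∷ Ms) = ∩-isLeftIdeal M (⋂-isLeftIdeal Ms)

  𝓜-maximal : ∀ J → All (IsMaximalIn J) (𝓜 J)
  𝓜-maximal J = All.all-filter (isMaximalIn? J) (allSubsets n)

  maximal-above : ∀ J {K} → IsLeftIdeal K → K ⊂ J → ∃[ M ] (IsMaximalIn J M × K ⊆ M)
  maximal-above J {K} = go (⊃-wellFounded K)
    where
    go : ∀ {K} → Acc _⊃_ K → IsLeftIdeal K → K ⊂ J → ∃[ M ] (IsMaximalIn J M × K ⊆ M)
    go {K} (acc larger) K-ideal K⊂J
      with anySubset? (λ L → isLeftIdeal? L ×-dec (K ⊂? L) ×-dec (L ⊂? J))
    ... | no  ∄L = K , (K-ideal , K⊂J , ∄L) , ⊆-refl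
    ... | yes (L , L-ideal , K⊂L , L⊂J) with go (larger K⊂L) L-ideal L⊂J
    ...   | M , M-max , L⊆M = M , M-max , ⊆-trans (proj₁ K⊂L) L⊆M

  [x]ℓ≡⟨x⟩ℓ─⋃𝓜 : ∀ x → [ x ]ℓ ≡ ⟨ x ⟩ℓ ─ ⋃ (𝓜 ⟨ x ⟩ℓ)
  [x]ℓ≡⟨x⟩ℓ─⋃𝓜 x = ⊆-antisym generator⇒outside outside⇒generator
    where
    J : Subset n
    J = ⟨ x ⟩ℓ
    Ms : List (Subset n)
    Ms = 𝓜 J

    generates? : ∀ i → Dec (⟨ elt i ⟩ℓ ≡ J)
    generates? i = ⟨ elt i ⟩ℓ ≟ₛ J

    generator⇒outside : [ x ]ℓ ⊆ J ─ ⋃ Ms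
    generator⇒outside {i} i∈ = x∈p∧x∉q⇒x∈p─q (subst (i ∈_) ⟨i⟩≡J (x∈⟨x⟩ℓ i)) (not-in-maximal ∘ x∈⋃⁻ Ms)
      where
      ⟨i⟩≡J : ⟨ elt i ⟩ℓ ≡ J
      ⟨i⟩≡J = ∈-tabulate⁻ generates? i∈
      i∉maximal : ∀ {M} → IsMaximalIn J M → i ∉ M
      i∉maximal (M-ideal , (_ , j , j∈J , j∉M) , _) i∈M =
        j∉M (⟨⟩ℓ-least M-ideal i∈M (subst (j ∈_) (≡.sym ⟨i⟩≡J) j∈J))
      not-in-maximal : ¬ Any (i ∈_) Ms
      not-in-maximal = lookupWith i∉maximal (𝓜-maximal J)

    outside⇒generator : J ─ ⋃ Ms ⊆ [ x ]ℓ
    outside⇒generator {i} i∈ = ∈-tabulate⁺ generates? ⟨i⟩≡J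
      where
      ⟨i⟩≡J : ⟨ elt i ⟩ℓ ≡ J
      ⟨i⟩≡J with generates? i
      ... | yes ⟨i⟩≡J = ⟨i⟩≡J
      ... | no  ⟨i⟩≢J with maximal-above J (⟨⟩ℓ-isLeftIdeal (elt i))
                             (⊆∧≢⇒⊂ (⟨⟩ℓ-least (⟨⟩ℓ-isLeftIdeal x) (p─q⊆p J (⋃ Ms) i∈)) ⟨i⟩≢J)
      ...   | M , M-max , ⟨i⟩⊆M = ⊥-elim (x∈p─q⇒x∉q i∈ (x∈⋃⁺ (lose M∈Ms (⟨i⟩⊆M (x∈⟨x⟩ℓ i)))))
        where
        M∈Ms : M List.∈ Ms
        M∈Ms = ∈-filter⁺ (isMaximalIn? J) (∈-allSubsets M) M-max

open import Data.Integer as ℤ using (ℤ; +_; _+_; _*_; -_)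
import Data.Integer.Properties as ℤ
open import Algebra.Properties.Group (AbelianGroup.group ℤ.+-0-abelianGroup) using (\\-leftDividesʳ)
open import Algebra.Properties.CommutativeSemigroup ℤ.+-commutativeSemigroup
  using () renaming (interchange to +-interchange)
open import Algebra.Properties.CommutativeSemigroup ℤ.*-commutativeSemigroup
  using () renaming (x∙yz≈y∙xz to *-left-comm)
open ≡ using (sym; trans)
open ≡.≡-Reasoning

∑ : ∀ {a} {A : Set a} → List A → (A → ℤ) → ℤ
∑ xs f = sumℤ (map f xs)

χ : ∀ {p} {P : Set p} → Dec P → ℤ
χ d = if does d then + 1 else + 0

module _ {p} {P : Set p} where

  χ-yes : (d : Dec P) → P → χ d ≡ + 1
  χ-yes d x rewrite dec-true d x = refl

  χ-no : (d : Dec P) → ¬ P → χ d ≡ + 0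
  χ-no d ¬x rewrite dec-false d ¬x = refl

module _ {a} {A : Set a} where

  ∑-++ : ∀ (xs ys : List A) f → ∑ (xs ++ ys) f ≡ ∑ xs f + ∑ ys f
  ∑-++ []       ys f = sym (ℤ.+-identityˡ _)
  ∑-++ (x ∷ xs) ys f = trans (cong (_+_ (f x)) (∑-++ xs ys f)) (sym (ℤ.+-assoc (f x) _ _))

  ∑-map : ∀ {b} {B : Set b} (g : B → A) (xs : List B) f → ∑ (map g xs) f ≡ ∑ xs (λ x → f (g x))
  ∑-map g []       f = refl
  ∑-map g (x ∷ xs) f = cong (_+_ (f (g x))) (∑-map g xs f)

  ∑-congAll : ∀ {p} {P : Pred A p} {xs f g} → All P xs → (∀ {x} → P x → f x ≡ g x) → ∑ xs f ≡ ∑ xs g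
  ∑-congAll []         eq = refl
  ∑-congAll (px ∷ pxs) eq = cong₂ _+_ (eq px) (∑-congAll pxs eq)

  ∑-cong : ∀ xs {f g : A → ℤ} → (∀ x → f x ≡ g x) → ∑ xs f ≡ ∑ xs g
  ∑-cong []       eq = refl
  ∑-cong (x ∷ xs) eq = cong₂ _+_ (eq x) (∑-cong xs eq)

  ∑-zero : ∀ xs {f : A → ℤ} → (∀ x → f x ≡ + 0) → ∑ xs f ≡ + 0
  ∑-zero []       eq = refl
  ∑-zero (x ∷ xs) eq = cong₂ _+_ (eq x) (∑-zero xs eq)

  ∑-+ : ∀ (xs : List A) f g → ∑ xs (λ x → f x + g x) ≡ ∑ xs f + ∑ xs g
  ∑-+ []       f g = refl
  ∑-+ (x ∷ xs) f g =
    trans (cong (_+_ (f x + g x)) (∑-+ xs f g)) (+-interchange (f x) (g x) (∑ xs f) (∑ xs g))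

  ∑-*ˡ : ∀ c (xs : List A) f → c * ∑ xs f ≡ ∑ xs (λ x → c * f x)
  ∑-*ˡ c []       f = ℤ.*-zeroʳ c
  ∑-*ˡ c (x ∷ xs) f = trans (ℤ.*-distribˡ-+ c (f x) _) (cong (_+_ (c * f x)) (∑-*ˡ c xs f))

  ∑-neg : ∀ (xs : List A) f → ∑ xs (λ x → - f x) ≡ - ∑ xs f
  ∑-neg []       f = refl
  ∑-neg (x ∷ xs) f = trans (cong (_+_ (- f x)) (∑-neg xs f)) (sym (ℤ.neg-distrib-+ (f x) _))

  ∑-filter : ∀ {p} {P : Pred A p} (P? : Decidable P) xs f →
             ∑ (filter P? xs) f ≡ ∑ xs (λ x → χ (P? x) * f x)
  ∑-filter P? []       f = refl
  ∑-filter P? (x ∷ xs) f with does (P? x)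
  ... | true  = cong₂ _+_ (sym (ℤ.*-identityˡ (f x))) (∑-filter P? xs f)
  ... | false = trans (∑-filter P? xs f) (sym (ℤ.+-identityˡ _))

∑-swap : ∀ {a b} {A : Set a} {B : Set b} (xs : List A) (ys : List B) (f : A → B → ℤ) →
         ∑ xs (λ x → ∑ ys (f x)) ≡ ∑ ys (λ y → ∑ xs (λ x → f x y))
∑-swap []       ys f = sym (∑-zero ys (λ _ → refl))
∑-swap (x ∷ xs) ys f =
  trans (cong (_+_ (∑ ys (f x))) (∑-swap xs ys f)) (sym (∑-+ ys (f x) (λ y → ∑ xs (λ x → f x y))))

module _ {a} {A : Set a} where

  ∑-sublists-∷ : ∀ x (xs : List A) f →
                 ∑ (sublists (x ∷ xs)) f ≡ ∑ (sublists xs) (λ E → f (x ∷ E)) + ∑ (sublists xs) f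
  ∑-sublists-∷ x xs f =
    trans (∑-++ (map (x ∷_) (sublists xs)) (sublists xs) f)
          (cong (_+ ∑ (sublists xs) f) (∑-map (x ∷_) (sublists xs) f))

  All-sublists : ∀ {p} {P : Pred A p} {xs} → All P xs → All (All P) (sublists xs)
  All-sublists []         = [] ∷ []
  All-sublists (px ∷ pxs) =
    All.++⁺ (All.map⁺ (All.map (px ∷_) (All-sublists pxs))) (All-sublists pxs)

  ∑-sublists-[] : ∀ {p} {P : Pred A p} {xs} {f : List A → ℤ} → All P xs →
                  (∀ {y E} → All P (y ∷ E) → f (y ∷ E) ≡ + 0) → ∑ (sublists xs) f ≡ f []
  ∑-sublists-[] {xs = []}     []         f∷≡0 = ℤ.+-identityʳ _
  ∑-sublists-[] {xs = x ∷ xs} {f} (px ∷ pxs) f∷≡0 = begin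
    ∑ (sublists (x ∷ xs)) f                                ≡⟨ ∑-sublists-∷ x xs f ⟩
    ∑ (sublists xs) (λ E → f (x ∷ E)) + ∑ (sublists xs) f
      ≡⟨ cong₂ _+_ f∷E≡0 (∑-sublists-[] pxs f∷≡0) ⟩
    + 0 + f []                                             ≡⟨ ℤ.+-identityˡ (f []) ⟩
    f []                                                   ∎
    where
    f∷E≡0 : ∑ (sublists xs) (λ E → f (x ∷ E)) ≡ + 0
    f∷E≡0 = trans (∑-congAll (All-sublists pxs) (λ pE → f∷≡0 (px ∷ pE)))
                  (∑-zero (sublists xs) (λ _ → refl))

∑-allSubsets-suc : ∀ n (f : Subset (suc n) → ℤ) →
                   ∑ (allSubsets (suc n)) f
                   ≡ ∑ (allSubsets n) (λ I → f (inside ∷ I)) + ∑ (allSubsets n) (λ I → f (outside ∷ I))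
∑-allSubsets-suc n f =
  trans (∑-++ (map (inside ∷_) (allSubsets n)) (map (outside ∷_) (allSubsets n)) f)
        (cong₂ _+_ (∑-map (inside ∷_) (allSubsets n) f) (∑-map (outside ∷_) (allSubsets n) f))

∑-allSubsets-δ : ∀ {n} (T : Subset n) (h : Subset n → ℤ) →
                 ∑ (allSubsets n) (λ I → χ (T ≟ₛ I) * h I) ≡ h T
∑-allSubsets-δ []          h = trans (ℤ.+-identityʳ _) (ℤ.*-identityˡ (h []))
∑-allSubsets-δ {suc n} (inside ∷ T) h = begin
  ∑ (allSubsets (suc n)) _  ≡⟨ ∑-allSubsets-suc n _ ⟩
  ∑ (allSubsets n) (λ I → χ (T ≟ₛ I) * h (inside ∷ I)) + ∑ (allSubsets n) (λ _ → + 0)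
    ≡⟨ cong₂ _+_ (∑-allSubsets-δ T (λ I → h (inside ∷ I))) (∑-zero (allSubsets n) (λ _ → refl)) ⟩
  h (inside ∷ T) + + 0       ≡⟨ ℤ.+-identityʳ _ ⟩
  h (inside ∷ T)             ∎
∑-allSubsets-δ {suc n} (outside ∷ T) h = begin
  ∑ (allSubsets (suc n)) _  ≡⟨ ∑-allSubsets-suc n _ ⟩
  ∑ (allSubsets n) (λ _ → + 0) + ∑ (allSubsets n) (λ I → χ (T ≟ₛ I) * h (outside ∷ I))
    ≡⟨ cong₂ _+_ (∑-zero (allSubsets n) (λ _ → refl)) (∑-allSubsets-δ T (λ I → h (outside ∷ I))) ⟩
  + 0 + h (outside ∷ T)      ≡⟨ ℤ.+-identityˡ _ ⟩
  h (outside ∷ T)            ∎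

∑-allSubsets-fibres : ∀ {n b} {B : Set b} (φ : B → Subset n) (xs : List B)
                      (g : Subset n → ℤ) (s : B → ℤ) →
  ∑ (allSubsets n) (λ I → g I * ∑ xs (λ y → χ (φ y ≟ₛ I) * s y)) ≡ ∑ xs (λ y → g (φ y) * s y)
∑-allSubsets-fibres {n} φ xs g s = begin
  ∑ (allSubsets n) (λ I → g I * ∑ xs (λ y → χ (φ y ≟ₛ I) * s y))
    ≡⟨ ∑-cong (allSubsets n) (λ I → ∑-*ˡ (g I) xs _) ⟩
  ∑ (allSubsets n) (λ I → ∑ xs (λ y → g I * (χ (φ y ≟ₛ I) * s y)))
    ≡⟨ ∑-swap (allSubsets n) xs _ ⟩
  ∑ xs (λ y → ∑ (allSubsets n) (λ I → g I * (χ (φ y ≟ₛ I) * s y)))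
    ≡⟨ ∑-cong xs (λ y → ∑-cong (allSubsets n) (λ I → *-left-comm (g I) (χ (φ y ≟ₛ I)) (s y))) ⟩
  ∑ xs (λ y → ∑ (allSubsets n) (λ I → χ (φ y ≟ₛ I) * (g I * s y)))
    ≡⟨ ∑-cong xs (λ y → ∑-allSubsets-δ (φ y) (λ I → g I * s y)) ⟩
  ∑ xs (λ y → g (φ y) * s y) ∎

inclusion–exclusion : ∀ {n} (Ms : List (Subset n)) p →
  + ∣ p ─ ⋃ Ms ∣ ≡ ∑ (sublists Ms) (λ E → sign (length E) * + ∣ p ∩ ⋂ E ∣)
inclusion–exclusion [] p = begin
  + ∣ p ─ ⊥ ∣                   ≡⟨ cong (+_ ∘ ∣_∣) (trans (p─⊥≡p p) (sym (∩-identityʳ p))) ⟩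
  + ∣ p ∩ ⊤ ∣                   ≡⟨ ℤ.*-identityˡ _ ⟨
  + 1 * + ∣ p ∩ ⊤ ∣             ≡⟨ ℤ.+-identityʳ _ ⟨
  + 1 * + ∣ p ∩ ⊤ ∣ + + 0       ∎
inclusion–exclusion {n} (M ∷ Ns) p = begin
  + ∣ p ─ (M ∪ ⋃ Ns) ∣
    ≡⟨ cong (+_ ∘ ∣_∣) (trans (cong (p ─_) (∪-comm M (⋃ Ns))) (sym (p─q─r≡p─q∪r p (⋃ Ns) M))) ⟩
  + ∣ p ─ ⋃ Ns ─ M ∣
    ≡⟨ \\-leftDividesʳ (+ ∣ (p ─ ⋃ Ns) ∩ M ∣) _ ⟨
  - + ∣ (p ─ ⋃ Ns) ∩ M ∣ + (+ ∣ (p ─ ⋃ Ns) ∩ M ∣ + + ∣ p ─ ⋃ Ns ─ M ∣)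
    ≡⟨ cong₂ (λ a b → - + ∣ a ∣ + b) (p─q∩r≡p∩r─q p (⋃ Ns) M) (sym (split (p ─ ⋃ Ns) M)) ⟩
  - + ∣ p ∩ M ─ ⋃ Ns ∣ + + ∣ p ─ ⋃ Ns ∣
    ≡⟨ cong₂ _+_ (cong -_ (inclusion–exclusion Ns (p ∩ M))) (inclusion–exclusion Ns p) ⟩
  - ∑ Es (λ E → sign (length E) * + ∣ (p ∩ M) ∩ ⋂ E ∣) + ∑ Es (λ E → sign (length E) * + ∣ p ∩ ⋂ E ∣)
    ≡⟨ cong (_+ _) (trans (∑-cong Es add-M) (∑-neg Es _)) ⟨
  ∑ Es (λ E → sign (length (M ∷ E)) * + ∣ p ∩ ⋂ (M ∷ E) ∣) + ∑ Es (λ E → sign (length E) * + ∣ p ∩ ⋂ E ∣)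
    ≡⟨ ∑-sublists-∷ M Ns _ ⟨
  ∑ (sublists (M ∷ Ns)) (λ E → sign (length E) * + ∣ p ∩ ⋂ E ∣) ∎
  where
  Es : List (List (Subset n))
  Es = sublists Ns
  split : ∀ (a q : Subset n) → + ∣ a ∣ ≡ + ∣ a ∩ q ∣ + + ∣ a ─ q ∣
  split a q = trans (cong +_ (∣p∣≡∣p∩q∣+∣p─q∣ a q)) (ℤ.pos-+ ∣ a ∩ q ∣ ∣ a ─ q ∣)
  add-M : ∀ E → sign (length (M ∷ E)) * + ∣ p ∩ ⋂ (M ∷ E) ∣ ≡ - (sign (length E) * + ∣ (p ∩ M) ∩ ⋂ E ∣)
  add-M E = trans (cong (λ a → - sign (length E) * + ∣ a ∣) (sym (∩-assoc p M (⋂ E))))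
                  (sym (ℤ.neg-distribˡ-* (sign (length E)) _))

module Counting {c ℓ} (R : Ring c ℓ) (enum : Inverse (setoid (Fin n)) (Ring.setoid R)) where

  open FiniteRing R enum
  open LeftIdeals R enum

  maximal⊂ : ∀ J → All (_⊂ J) (𝓜 J)
  maximal⊂ J = All.map (proj₁ ∘ proj₂) (𝓜-maximal J)

  -- Only E = [] gives J ∩ ⋂ E = J; a nonempty E ⊆ 𝓜 J has ⋂ E ⊂ J, hence J ∩ ⋂ E = ⋂ E.
  μ-as-∑ : ∀ I J → μ I J ≡ ∑ (sublists (𝓜 J)) (λ E → χ ((J ∩ ⋂ E) ≟ₛ I) * sign (length E))
  μ-as-∑ I J with I ≟ₛ J
  ... | yes refl = sym (begin
    ∑ (sublists (𝓜 I)) (λ E → χ ((I ∩ ⋂ E) ≟ₛ I) * sign (length E))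
      ≡⟨ ∑-sublists-[] (maximal⊂ I) only-[] ⟩
    χ ((I ∩ ⊤) ≟ₛ I) * + 1   ≡⟨ ℤ.*-identityʳ _ ⟩
    χ ((I ∩ ⊤) ≟ₛ I)         ≡⟨ χ-yes ((I ∩ ⊤) ≟ₛ I) (∩-identityʳ I) ⟩
    + 1                      ∎)
    where
    only-[] : ∀ {M E} → All (_⊂ I) (M ∷ E) → χ ((I ∩ ⋂ (M ∷ E)) ≟ₛ I) * sign (length (M ∷ E)) ≡ + 0
    only-[] {M} {E} (M⊂I ∷ _) =
      cong (_* sign (length (M ∷ E))) (χ-no ((I ∩ ⋂ (M ∷ E)) ≟ₛ I) (p⊂q⇒q∩p≢q (p⊂r⇒p∩q⊂r M⊂I)))
  ... | no I≢J = trans (∑-filter _ (sublists (𝓜 J)) (sign ∘ length))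
                       (∑-congAll (All-sublists (maximal⊂ J)) same-terms)
    where
    same-terms : ∀ {E} → All (_⊂ J) E →
                 χ (nonEmpty? E ×-dec (⋂ E ≟ₛ I)) * sign (length E)
                 ≡ χ ((J ∩ ⋂ E) ≟ₛ I) * sign (length E)
    same-terms [] =
      sym (cong (_* + 1) (χ-no ((J ∩ ⊤) ≟ₛ I) (λ J∩⊤≡I → I≢J (trans (sym J∩⊤≡I) (∩-identityʳ J)))))
    same-terms {M ∷ E} (M⊂J ∷ _) =
      cong (λ S → χ (S ≟ₛ I) * sign (length (M ∷ E))) (sym (p⊆q⇒q∩p≡p (proj₁ (p⊂r⇒p∩q⊂r M⊂J))))

  idealSize : Subset n → Subset n → ℤ
  idealSize J I = χ (isLeftIdeal? I) * χ (I ⊆? J) * + ∣ I ∣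

  idealSize-≡ : ∀ {J I} → IsLeftIdeal I → I ⊆ J → idealSize J I ≡ + ∣ I ∣
  idealSize-≡ {J} {I} I-ideal I⊆J
    rewrite χ-yes (isLeftIdeal? I) I-ideal | χ-yes (I ⊆? J) I⊆J = ℤ.*-identityˡ (+ ∣ I ∣)

  rhs-as-∑ : ∀ x → rhs x ≡ ∑ (allSubsets n) (λ I → idealSize ⟨ x ⟩ℓ I * μ I ⟨ x ⟩ℓ)
  rhs-as-∑ x = begin
    rhs x
      ≡⟨ ∑-filter (_⊆? J) leftIdeals _ ⟩
    ∑ leftIdeals (λ I → χ (I ⊆? J) * (+ ∣ I ∣ * μ I J))
      ≡⟨ ∑-filter isLeftIdeal? (allSubsets n) _ ⟩
    ∑ (allSubsets n) (λ I → χ (isLeftIdeal? I) * (χ (I ⊆? J) * (+ ∣ I ∣ * μ I J)))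
      ≡⟨ ∑-cong (allSubsets n) (λ I → reassoc (χ (isLeftIdeal? I)) (χ (I ⊆? J)) (+ ∣ I ∣) (μ I J)) ⟩
    ∑ (allSubsets n) (λ I → idealSize J I * μ I J) ∎
    where
    J : Subset n
    J = ⟨ x ⟩ℓ
    reassoc : ∀ a b c d → a * (b * (c * d)) ≡ a * b * c * d
    reassoc a b c d = sym (trans (ℤ.*-assoc (a * b) c d) (ℤ.*-assoc a b (c * d)))

lemma3p3 : ∀ {c ℓ} (R : Ring c ℓ) (n : ℕ)
           (enum : Inverse (setoid (Fin n)) (Ring.setoid R))
           (x : Ring.Carrier R) →
           + ∣ FiniteRing.[_]ℓ R enum x ∣ ≡ FiniteRing.rhs R enum x
lemma3p3 R n enum x = begin
  + ∣ [ x ]ℓ ∣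
    ≡⟨ cong (+_ ∘ ∣_∣) ([x]ℓ≡⟨x⟩ℓ─⋃𝓜 x) ⟩
  + ∣ J ─ ⋃ (𝓜 J) ∣
    ≡⟨ inclusion–exclusion (𝓜 J) J ⟩
  ∑ Es (λ E → sign (length E) * + ∣ J ∩ ⋂ E ∣)
    ≡⟨ ∑-congAll (All-sublists (𝓜-maximal J)) size≡idealSize ⟩
  ∑ Es (λ E → idealSize J (J ∩ ⋂ E) * sign (length E))
    ≡⟨ ∑-allSubsets-fibres (λ E → J ∩ ⋂ E) Es (idealSize J) (sign ∘ length) ⟨
  ∑ (allSubsets n) (λ I → idealSize J I * ∑ Es (λ E → χ ((J ∩ ⋂ E) ≟ₛ I) * sign (length E)))
    ≡⟨ ∑-cong (allSubsets n) (λ I → cong (idealSize J I *_) (μ-as-∑ I J)) ⟨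
  ∑ (allSubsets n) (λ I → idealSize J I * μ I J)
    ≡⟨ rhs-as-∑ x ⟨
  rhs x ∎
  where
  open FiniteRing R enum
  open LeftIdeals R enum
  open Counting R enum
  J : Subset n
  J = ⟨ x ⟩ℓ
  Es : List (List (Subset n))
  Es = sublists (𝓜 J)
  size≡idealSize : ∀ {E} → All (IsMaximalIn J) E →
                   sign (length E) * + ∣ J ∩ ⋂ E ∣ ≡ idealSize J (J ∩ ⋂ E) * sign (length E)
  size≡idealSize {E} E-max =
    trans (ℤ.*-comm (sign (length E)) _) (cong (_* sign (length E)) (sym (idealSize-≡ J∩⋂E-ideal (p∩q⊆p J (⋂ E)))))
    where
    J∩⋂E-ideal : IsLeftIdeal (J ∩ ⋂ E)
    J∩⋂E-ideal = ∩-isLeftIdeal (⟨⟩ℓ-isLeftIdeal x) (⋂-isLeftIdeal (All.map proj₁ E-max))
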